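{- Let $1/n\ll\nu\leq\tau\ll\eta\ll1$. Suppose that $G$ is a digraph on $n$ vertices which is a robust $(\nu,\tau)$-diexpander with $\delta^0(G)\geq\eta n$. Let $k$ be an integer with $\lceil 2/\nu\rceil\leq k\leq \nu n/4$ and let $x,y\in V(G)$ be distinct. Then for any orientation $P$ of a path of length $k$, there is a path in $G$ from $x$ to $y$ isomorphic to $P$.
   Context: $\delta^0(G)=\min(\delta^+(G),\delta^-(G))$. For $S\subseteq V(G)$, $RN^+_{\nu,G}(S)$ (resp. $RN^-_{\nu,G}(S)$) is the set of vertices with at least $\nu n$ inneighbours (resp. outneighbours) in $S$. $G$ is a robust $(\nu,\tau)$-diexpander if both $|RN^+_{\nu,G}(S)|\geq|S|+\nu n$ and $|RN^-_{\nu,G}(S)|\geq |S|+\nu n$ for all $S\subseteq V(G)$ with $\tau n<|S|<(1-\tau)n$. An orientation of a path of length $k$ is an oriented graph obtained by orienting each edge of an undirected path $u_0u_1\ldots u_k$ arbitrarily; a path in $G$ from $x$ to $y$ isomorphic to $P$ means an injective map sending $u_0$ to $x$, $u_k$ to $y$ and each edge of $P$ to an edge of $G$ with the same orientation. The notation $a\ll b$ means $a$ is sufficiently small in terms of $b$.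
   Formalization: The constants ν, τ and η of the hierarchy range over the rationals. -}

module Defs where

open import Data.Nat as ℕ using (ℕ; zero; suc)
open import Data.Integer as ℤ using (ℤ; +_)
open import Data.Rational as ℚ using (ℚ; 0ℚ; 1ℚ; _≤ᵇ_; _÷_; ceiling)
open import Data.Rational.Properties using (pos⇒nonZero)
open import Data.Bool using (Bool; true; false; if_then_else_)
open import Data.Fin using (Fin; fromℕ; inject₁) renaming (zero to fzero; suc to fsuc)
open import Data.Fin.Subset using (Subset; ∣_∣; _∩_)
open import Data.Vec using (Vec; tabulate; lookup)
open import Data.Product using (Σ; _×_)
open import Function.Definitions using (Injective)
open import Relation.Binary.PropositionalEquality using (_≡_)

-- A digraph on vertex set Fin n: loopless adjacency relation (u → v iff adj u v ≡ true).
-- Both directions between two vertices are allowed (digraph, not oriented graph).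
record Digraph (n : ℕ) : Set where
  field
    adj      : Fin n → Fin n → Bool
    loopless : ∀ v → adj v v ≡ false
open Digraph public

ℕtoℚ : ℕ → ℚ
ℕtoℚ m = (+ m) ℚ./ 1

module _ {n : ℕ} (G : Digraph n) where
  N⁺ : Fin n → Subset n
  N⁺ v = tabulate (λ w → adj G v w)

  N⁻ : Fin n → Subset n
  N⁻ v = tabulate (λ u → adj G u v)

  outdeg indeg : Fin n → ℕ
  outdeg v = ∣ N⁺ v ∣
  indeg v = ∣ N⁻ v ∣

  minSemiDegreeAtLeast : ℚ → Set
  minSemiDegreeAtLeast η =
    ∀ v → (η ℚ.* ℕtoℚ n ℚ.≤ ℕtoℚ (outdeg v)) × (η ℚ.* ℕtoℚ n ℚ.≤ ℕtoℚ (indeg v))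

  RN⁺ : ℚ → Subset n → Subset n
  RN⁺ ν S = tabulate (λ v → ν ℚ.* ℕtoℚ n ≤ᵇ ℕtoℚ ∣ S ∩ N⁻ v ∣)

  RN⁻ : ℚ → Subset n → Subset n
  RN⁻ ν S = tabulate (λ v → ν ℚ.* ℕtoℚ n ≤ᵇ ℕtoℚ ∣ S ∩ N⁺ v ∣)

  RobustDiexpander : ℚ → ℚ → Set
  RobustDiexpander ν τ =
    ∀ (S : Subset n) →
      τ ℚ.* ℕtoℚ n ℚ.< ℕtoℚ ∣ S ∣ →
      ℕtoℚ ∣ S ∣ ℚ.< (1ℚ ℚ.- τ) ℚ.* ℕtoℚ n →
      (ℕtoℚ ∣ S ∣ ℚ.+ ν ℚ.* ℕtoℚ n ℚ.≤ ℕtoℚ ∣ RN⁺ ν S ∣) ×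
      (ℕtoℚ ∣ S ∣ ℚ.+ ν ℚ.* ℕtoℚ n ℚ.≤ ℕtoℚ ∣ RN⁻ ν S ∣)

-- An orientation of a path u₀u₁…u_k of length k: for each i < k,
-- true means the edge is u_i → u_{i+1}, false means u_{i+1} → u_i.
PathOrientation : ℕ → Set
PathOrientation k = Vec Bool k

IsomorphicPathFromTo : {n k : ℕ} (G : Digraph n) (P : PathOrientation k) (x y : Fin n) →
                       (Fin (suc k) → Fin n) → Set
IsomorphicPathFromTo {n} {k} G P x y f =
  Injective _≡_ _≡_ f ×
  (f fzero ≡ x) × (f (fromℕ k) ≡ y) ×
  (∀ (i : Fin k) →
     (if lookup P i
       then adj G (f (inject₁ i)) (f (fsuc i))
       else adj G (f (fsuc i)) (f (inject₁ i))) ≡ true)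

⌈2/_⌉ : (ν : ℚ) → 0ℚ ℚ.< ν → ℤ
⌈2/ ν ⌉ p = ceiling (_÷_ (ℕtoℚ 2) ν {{pos⇒nonZero ν {{ℚ.positive p}}}})

_÷4 : ℚ → ℚ
q ÷4 = q ℚ.* ((+ 1) ℚ./ 4)

-- Embed P backwards from y.  For an orientation σ of a final segment of P let T(σ) be a set of
-- vertices from which σ can be completed to y: for a single edge the appropriate neighbourhood of y,
-- and otherwise the robust out- or in-neighbourhood of T(σ′), where σ′ is σ without its first edge.
-- Robust expansion makes T grow by d = ⌊νn⌋ per edge until it leaves the range (τn, (1-τ)n), so
-- as (k-2)d > n the first vertex x has a neighbour v ∉ {x, y} of the right direction in T(P′).
-- From v the path is completed greedily: each vertex of T(σ) has at least d > k neighbours of the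
-- right direction in T(σ′), so one of them avoids all vertices used so far.

module Submission where

open import Defs
import Data.Nat as ℕ
import Data.Rational as ℚ
open import Data.Fin.Subset using (∣_∣)
open import Data.Product using (_×_)

module RationalArithmetic where

  open import Data.Nat as ℕ using (ℕ; zero; suc)
  import Data.Nat.Properties as ℕ
  import Data.Nat.DivMod as ℕ
  import Data.Nat.Coprimality as Coprime
  open import Data.Integer as ℤ using (+_; -[1+_]; +[1+_])
  import Data.Integer.Properties as ℤ
  import Data.Integer.DivMod as ℤ
  import Data.Integer.Solver as ℤ
  open import Data.Rational as ℚ using (ℚ; mkℚ; 0ℚ; _≤_; _<_; _+_; _*_; _-_; -_)
  import Data.Rational.Properties as ℚ
  open import Data.Rational.Solver using (module +-*-Solver)
  import Data.Rational.Unnormalised as ℚᵘ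
  import Data.Rational.Unnormalised.Properties as ℚᵘ
  open import Data.Product using (∃-syntax; _×_; _,_)
  open import Relation.Binary.PropositionalEquality

  ℕtoℚ≡mkℚ : ∀ m → ℕtoℚ m ≡ mkℚ (+ m) 0 (Coprime.sym (Coprime.1-coprimeTo m))
  ℕtoℚ≡mkℚ m = ℚ.normalize-coprime (Coprime.sym (Coprime.1-coprimeTo m))

  ℕtoℚ-mono-≤ : ∀ {a b} → a ℕ.≤ b → ℕtoℚ a ≤ ℕtoℚ b
  ℕtoℚ-mono-≤ {a} {b} a≤b rewrite ℕtoℚ≡mkℚ a | ℕtoℚ≡mkℚ b =
    ℚ.*≤* (subst₂ ℤ._≤_ (sym (ℤ.*-identityʳ (+ a))) (sym (ℤ.*-identityʳ (+ b))) (ℤ.+≤+ a≤b))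

  ℕtoℚ-cancel-≤ : ∀ {a b} → ℕtoℚ a ≤ ℕtoℚ b → a ℕ.≤ b
  ℕtoℚ-cancel-≤ {a} {b} a≤b rewrite ℕtoℚ≡mkℚ a | ℕtoℚ≡mkℚ b =
    ℤ.drop‿+≤+ (subst₂ ℤ._≤_ (ℤ.*-identityʳ (+ a)) (ℤ.*-identityʳ (+ b)) (ℚ.drop-*≤* a≤b))

  ℕtoℚ-cancel-< : ∀ {a b} → ℕtoℚ a < ℕtoℚ b → a ℕ.< b
  ℕtoℚ-cancel-< {a} {b} a<b rewrite ℕtoℚ≡mkℚ a | ℕtoℚ≡mkℚ b =
    ℤ.drop‿+<+ (subst₂ ℤ._<_ (ℤ.*-identityʳ (+ a)) (ℤ.*-identityʳ (+ b)) (ℚ.drop-*<* a<b))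

  0≤ℕtoℚ : ∀ m → 0ℚ ≤ ℕtoℚ m
  0≤ℕtoℚ m = ℕtoℚ-mono-≤ {0} {m} ℕ.z≤n

  ℕtoℚ-homo-+ : ∀ a b → ℕtoℚ (a ℕ.+ b) ≡ ℕtoℚ a + ℕtoℚ b
  ℕtoℚ-homo-+ a b =
    ℚ.toℚᵘ-injective (ℚᵘ.≃-trans unnormalised (ℚᵘ.≃-sym (ℚ.toℚᵘ-homo-+ (ℕtoℚ a) (ℕtoℚ b))))
    where
    open ℤ.+-*-Solver
    unnormalised : ℚ.toℚᵘ (ℕtoℚ (a ℕ.+ b)) ℚᵘ.≃ ℚ.toℚᵘ (ℕtoℚ a) ℚᵘ.+ ℚ.toℚᵘ (ℕtoℚ b)
    unnormalised rewrite ℕtoℚ≡mkℚ (a ℕ.+ b) | ℕtoℚ≡mkℚ a | ℕtoℚ≡mkℚ b | ℤ.pos-+ a b = ℚᵘ.*≡*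
      (solve 2 (λ A B → (A :+ B) :* con (+ 1) := (A :* con (+ 1) :+ B :* con (+ 1)) :* con (+ 1))
             refl (+ a) (+ b))

  ℕtoℚ-homo-* : ∀ a b → ℕtoℚ (a ℕ.* b) ≡ ℕtoℚ a * ℕtoℚ b
  ℕtoℚ-homo-* a b =
    ℚ.toℚᵘ-injective (ℚᵘ.≃-trans unnormalised (ℚᵘ.≃-sym (ℚ.toℚᵘ-homo-* (ℕtoℚ a) (ℕtoℚ b))))
    where
    unnormalised : ℚ.toℚᵘ (ℕtoℚ (a ℕ.* b)) ℚᵘ.≃ ℚ.toℚᵘ (ℕtoℚ a) ℚᵘ.* ℚ.toℚᵘ (ℕtoℚ b)
    unnormalised rewrite ℕtoℚ≡mkℚ (a ℕ.* b) | ℕtoℚ≡mkℚ a | ℕtoℚ≡mkℚ b =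
      ℚᵘ.*≡* (cong (ℤ._* + 1) (ℤ.pos-* a b))

  m<[1+m/n]*n : ∀ m n .{{_ : ℕ.NonZero n}} → m ℕ.< suc (m ℕ./ n) ℕ.* n
  m<[1+m/n]*n m n = begin-strict
    m                         ≡⟨ ℕ.m≡m%n+[m/n]*n m n ⟩
    m ℕ.% n ℕ.+ m ℕ./ n ℕ.* n <⟨ ℕ.+-monoˡ-< (m ℕ./ n ℕ.* n) (ℕ.m%n<n m n) ⟩
    n ℕ.+ m ℕ./ n ℕ.* n       ∎
    where open ℕ.≤-Reasoning

  floorℕ : ∀ q → 0ℚ ≤ q → ∃[ m ] ℕtoℚ m ≤ q × q < ℕtoℚ (suc m)
  floorℕ (mkℚ -[1+ a ] b _) (ℚ.*≤* ())
  floorℕ q@(mkℚ (+ a) b _) _ = a ℕ./ suc b , m≤q , q<1+m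
    where
    m≤q : ℕtoℚ (a ℕ./ suc b) ≤ q
    m≤q rewrite ℕtoℚ≡mkℚ (a ℕ./ suc b) = ℚ.*≤* (subst₂ ℤ._≤_
      (ℤ.pos-* (a ℕ./ suc b) (suc b)) (sym (ℤ.*-identityʳ (+ a))) (ℤ.+≤+ (ℕ.m/n*n≤m a (suc b))))
    q<1+m : q < ℕtoℚ (suc (a ℕ./ suc b))
    q<1+m rewrite ℕtoℚ≡mkℚ (suc (a ℕ./ suc b)) = ℚ.*<* (subst₂ ℤ._<_
      (sym (ℤ.*-identityʳ (+ a))) (ℤ.pos-* (suc (a ℕ./ suc b)) (suc b)) (ℤ.+<+ (m<[1+m/n]*n a (suc b))))

  ceiling-mkℚ : ∀ a b .(c : Coprime.Coprime ℤ.∣ a ∣ (suc b)) →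
                ℚ.ceiling (mkℚ a b c) ≡ ℤ.- ((ℤ.- a) ℤ./ + suc b)
  ceiling-mkℚ (+ zero) b c = refl
  ceiling-mkℚ +[1+ a ] b c = refl
  ceiling-mkℚ -[1+ a ] b c = refl

  i≤-[-i/d]*d : ∀ i d .{{_ : ℤ.NonZero (+ d)}} → i ℤ.≤ ℤ.- ((ℤ.- i) ℤ./ + d) ℤ.* + d
  i≤-[-i/d]*d i d = subst₂ ℤ._≤_ (ℤ.neg-involutive i) (ℤ.neg-distribˡ-* ((ℤ.- i) ℤ./ + d) (+ d))
    (ℤ.neg-mono-≤ (ℤ.[n/d]*d≤n (ℤ.- i) (+ d)))

  ceiling≤⇒≤ : ∀ q k → ℚ.ceiling q ℤ.≤ + k → q ≤ ℕtoℚ k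
  ceiling≤⇒≤ (mkℚ a b c) k ⌈q⌉≤k rewrite ℕtoℚ≡mkℚ k | ceiling-mkℚ a b c = ℚ.*≤* (begin
    a ℤ.* + 1                             ≡⟨ ℤ.*-identityʳ a ⟩
    a                                     ≤⟨ i≤-[-i/d]*d a (suc b) ⟩
    ℤ.- ((ℤ.- a) ℤ./ + suc b) ℤ.* + suc b ≤⟨ ℤ.*-monoʳ-≤-nonNeg (+ suc b) ⌈q⌉≤k ⟩
    + k ℤ.* + suc b                       ∎)
    where open ℤ.≤-Reasoning

  -- Linear inequalities are proved by exhibiting q - p as an explicit nonnegative combination.
  q-p+p≡q : ∀ p q → q - p + p ≡ q
  q-p+p≡q = solve 2 (λ p q → q :- p :+ p := q) refl
    where open +-*-Solver

  ≤-from-slack : ∀ {p q s} → 0ℚ ≤ s → s ≡ q - p → p ≤ q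
  ≤-from-slack {p} {q} 0≤s refl = subst₂ _≤_ (ℚ.+-identityˡ p) (q-p+p≡q p q) (ℚ.+-monoˡ-≤ p 0≤s)

  <-from-slack : ∀ {p q s} → 0ℚ < s → s ≡ q - p → p < q
  <-from-slack {p} {q} 0<s refl = subst₂ _<_ (ℚ.+-identityˡ p) (q-p+p≡q p q) (ℚ.+-monoˡ-< p 0<s)

  0≤-slack : ∀ {p q} → p ≤ q → 0ℚ ≤ q - p
  0≤-slack {p} {q} p≤q = subst (_≤ q - p) (ℚ.+-inverseʳ p) (ℚ.+-monoˡ-≤ (- p) p≤q)

  0<-slack : ∀ {p q} → p < q → 0ℚ < q - p
  0<-slack {p} {q} p<q = subst (_< q - p) (ℚ.+-inverseʳ p) (ℚ.+-monoˡ-< (- p) p<q)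

  0≤+ : ∀ {p q} → 0ℚ ≤ p → 0ℚ ≤ q → 0ℚ ≤ p + q
  0≤+ = ℚ.+-mono-≤

  0<+ : ∀ {p q} → 0ℚ < p → 0ℚ ≤ q → 0ℚ < p + q
  0<+ = ℚ.+-mono-<-≤

  0≤* : ∀ {p q} → 0ℚ ≤ p → 0ℚ ≤ q → 0ℚ ≤ p * q
  0≤* {p} {q} 0≤p 0≤q =
    ℚ.nonNegative⁻¹ (p * q) {{ℚ.nonNeg*nonNeg⇒nonNeg p {{ℚ.nonNegative 0≤p}} q {{ℚ.nonNegative 0≤q}}}}

  ⅛ ¼ : ℚ
  ⅛ = + 1 ℚ./ 8
  ¼ = + 1 ℚ./ 4

module SubsetCounting where

  open import Data.Nat as ℕ using (ℕ; zero; suc; _+_; _≤_; _<_; z≤n; s≤s)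
  import Data.Nat.Properties as ℕ
  open import Data.Bool using (Bool; true)
  open import Data.Fin using (Fin) renaming (zero to fzero; suc to fsuc)
  open import Data.Fin.Subset using (Subset; _∈_; _∉_; _⊆_; _∩_; ∣_∣; ⊥; inside; outside)
  open import Data.Fin.Subset.Properties using (⊥⊆; ∣⊥∣≡0; s⊆s; x∈p∩q⁺; x∈p∩q⁻; nonempty?; Empty-unique)
  open import Data.Vec using (Vec; []; _∷_; tabulate; here; there)
  open import Data.Vec.Properties using (lookup∘tabulate; lookup⇒[]=; []=⇒lookup)
  import Data.Vec.Relation.Unary.Any as Any
  open import Data.Vec.Membership.Propositional using () renaming (_∉_ to _∉ᵥ_)
  open import Data.Product using (∃-syntax; _×_; _,_)
  open import Relation.Nullary using (yes; no; contradiction)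
  open import Relation.Binary.PropositionalEquality

  private variable
    n m : ℕ

  ∈-tabulate⁺ : ∀ {f : Fin n → Bool} {v} → f v ≡ true → v ∈ tabulate f
  ∈-tabulate⁺ {f = f} {v} fv≡true = lookup⇒[]= v (tabulate f) (trans (lookup∘tabulate f v) fv≡true)

  ∈-tabulate⁻ : ∀ {f : Fin n → Bool} {v} → v ∈ tabulate f → f v ≡ true
  ∈-tabulate⁻ {f = f} {v} v∈ = trans (sym (lookup∘tabulate f v)) ([]=⇒lookup v∈)

  ∩-monoˡ-⊆ : ∀ {p q r : Subset n} → p ⊆ q → p ∩ r ⊆ q ∩ r
  ∩-monoˡ-⊆ {p = p} {r = r} p⊆q x∈p∩r with x∈p∩q⁻ p r x∈p∩r
  ... | x∈p , x∈r = x∈p∩q⁺ (p⊆q x∈p , x∈r)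

  ∣p∣+∣q∣≤∣p∩q∣+n : ∀ (p q : Subset n) → ∣ p ∣ + ∣ q ∣ ≤ ∣ p ∩ q ∣ + n
  ∣p∣+∣q∣≤∣p∩q∣+n []            []            = z≤n
  ∣p∣+∣q∣≤∣p∩q∣+n {suc n} (inside ∷ p) (inside ∷ q) = begin
    suc (∣ p ∣ + suc ∣ q ∣)   ≡⟨ cong suc (ℕ.+-suc ∣ p ∣ ∣ q ∣) ⟩
    suc (suc (∣ p ∣ + ∣ q ∣)) ≤⟨ s≤s (s≤s (∣p∣+∣q∣≤∣p∩q∣+n p q)) ⟩
    suc (suc (∣ p ∩ q ∣ + n)) ≡⟨ cong suc (ℕ.+-suc ∣ p ∩ q ∣ n) ⟨
    suc (∣ p ∩ q ∣ + suc n)   ∎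
    where open ℕ.≤-Reasoning
  ∣p∣+∣q∣≤∣p∩q∣+n {suc n} (inside ∷ p) (outside ∷ q) = begin
    suc (∣ p ∣ + ∣ q ∣) ≤⟨ s≤s (∣p∣+∣q∣≤∣p∩q∣+n p q) ⟩
    suc (∣ p ∩ q ∣ + n) ≡⟨ ℕ.+-suc ∣ p ∩ q ∣ n ⟨
    ∣ p ∩ q ∣ + suc n   ∎
    where open ℕ.≤-Reasoning
  ∣p∣+∣q∣≤∣p∩q∣+n {suc n} (outside ∷ p) (inside ∷ q) = begin
    ∣ p ∣ + suc ∣ q ∣   ≡⟨ ℕ.+-suc ∣ p ∣ ∣ q ∣ ⟩
    suc (∣ p ∣ + ∣ q ∣) ≤⟨ s≤s (∣p∣+∣q∣≤∣p∩q∣+n p q) ⟩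
    suc (∣ p ∩ q ∣ + n) ≡⟨ ℕ.+-suc ∣ p ∩ q ∣ n ⟨
    ∣ p ∩ q ∣ + suc n   ∎
    where open ℕ.≤-Reasoning
  ∣p∣+∣q∣≤∣p∩q∣+n {suc n} (outside ∷ p) (outside ∷ q) =
    ℕ.≤-trans (∣p∣+∣q∣≤∣p∩q∣+n p q) (ℕ.+-monoʳ-≤ ∣ p ∩ q ∣ (ℕ.n≤1+n n))

  ∃-subset-of-size : ∀ (p : Subset n) → m ≤ ∣ p ∣ → ∃[ q ] q ⊆ p × ∣ q ∣ ≡ m
  ∃-subset-of-size {n} {zero} p _ = ⊥ , ⊥⊆ , ∣⊥∣≡0 n
  ∃-subset-of-size {m = suc m} (inside ∷ p) (s≤s m≤∣p∣) with ∃-subset-of-size p m≤∣p∣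
  ... | q , q⊆p , ∣q∣≡m = inside ∷ q , s⊆s q⊆p , cong suc ∣q∣≡m
  ∃-subset-of-size {m = suc m} (outside ∷ p) m≤∣p∣ with ∃-subset-of-size p m≤∣p∣
  ... | q , q⊆p , ∣q∣≡m = outside ∷ q , s⊆s q⊆p , ∣q∣≡m

  -- The library's p - x is defined through _─_ and does not reduce on p = s ∷ p′; this one does.
  _∖_ : Subset n → Fin n → Subset n
  (_ ∷ p) ∖ fzero  = outside ∷ p
  (s ∷ p) ∖ fsuc x = s ∷ (p ∖ x)

  ∣p∣≤1+∣p∖x∣ : ∀ (p : Subset n) x → ∣ p ∣ ≤ suc ∣ p ∖ x ∣
  ∣p∣≤1+∣p∖x∣ (inside  ∷ p) fzero    = ℕ.≤-refl
  ∣p∣≤1+∣p∖x∣ (outside ∷ p) fzero    = ℕ.n≤1+n ∣ p ∣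
  ∣p∣≤1+∣p∖x∣ (inside  ∷ p) (fsuc x) = s≤s (∣p∣≤1+∣p∖x∣ p x)
  ∣p∣≤1+∣p∖x∣ (outside ∷ p) (fsuc x) = ∣p∣≤1+∣p∖x∣ p x

  p∖x⊆p : ∀ (p : Subset n) x → p ∖ x ⊆ p
  p∖x⊆p (_ ∷ p) fzero    (there y∈p)   = there y∈p
  p∖x⊆p (_ ∷ p) (fsuc x) here          = here
  p∖x⊆p (_ ∷ p) (fsuc x) (there y∈p∖x) = there (p∖x⊆p p x y∈p∖x)

  x∉p∖x : ∀ (p : Subset n) x → x ∉ p ∖ x
  x∉p∖x (_ ∷ p) fzero    ()
  x∉p∖x (_ ∷ p) (fsuc x) (there x∈p∖x) = x∉p∖x p x x∈p∖x

  ∃-∈-∉ᵥ : ∀ (p : Subset n) (us : Vec (Fin n) m) → m < ∣ p ∣ → ∃[ v ] v ∈ p × v ∉ᵥ us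
  ∃-∈-∉ᵥ {n} p [] 0<∣p∣ with nonempty? p
  ... | yes (v , v∈p) = v , v∈p , λ ()
  ... | no p-empty    = contradiction (subst (λ q → 0 < ∣ q ∣) (Empty-unique p-empty) 0<∣p∣)
                                      (ℕ.<-irrefl (sym (∣⊥∣≡0 n)))
  ∃-∈-∉ᵥ p (u ∷ us) m<∣p∣ with ∃-∈-∉ᵥ (p ∖ u) us (ℕ.≤-pred (ℕ.≤-trans m<∣p∣ (∣p∣≤1+∣p∖x∣ p u)))
  ... | v , v∈p∖u , v∉us = v , p∖x⊆p p u v∈p∖u , λ
    { (Any.here refl)    → x∉p∖x p u v∈p∖u
    ; (Any.there v∈us) → v∉us v∈us }

  ∃-∈∩-∉ᵥ : ∀ (p q : Subset n) (us : Vec (Fin n) m) → m < ∣ p ∩ q ∣ → ∃[ v ] v ∈ p × v ∈ q × v ∉ᵥ us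
  ∃-∈∩-∉ᵥ p q us m<∣p∩q∣ with ∃-∈-∉ᵥ (p ∩ q) us m<∣p∩q∣
  ... | v , v∈p∩q , v∉us with x∈p∩q⁻ p q v∈p∩q
  ...   | v∈p , v∈q = v , v∈p , v∈q , v∉us

  ∉ᵥ-∷⁺ : ∀ {A : Set} {x y : A} {ys : Vec A m} → x ≢ y → x ∉ᵥ ys → x ∉ᵥ y ∷ ys
  ∉ᵥ-∷⁺ x≢y _    (Any.here x≡y)   = x≢y x≡y
  ∉ᵥ-∷⁺ _   x∉ys (Any.there x∈ys) = x∉ys x∈ys

module PathEmbedding {n : ℕ.ℕ} (G : Digraph n) (ν : ℚ.ℚ) (d lo hi : ℕ.ℕ)
  (d≤νn : ℕtoℚ d ℚ.≤ ν ℚ.* ℕtoℚ n)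
  (expands : ∀ S → lo ℕ.≤ ∣ S ∣ → ∣ S ∣ ℕ.≤ hi →
             (∣ S ∣ ℕ.+ d ℕ.≤ ∣ RN⁺ G ν S ∣) × (∣ S ∣ ℕ.+ d ℕ.≤ ∣ RN⁻ G ν S ∣))
  (lo≤δ⁰ : ∀ v → (lo ℕ.≤ outdeg G v) × (lo ℕ.≤ indeg G v))
  (lo≤hi : lo ℕ.≤ hi)
  (n+3≤lo+hi+d : n ℕ.+ 3 ℕ.≤ lo ℕ.+ (hi ℕ.+ d))
  where

  open import Data.Nat as ℕ using (ℕ; suc; _+_; _*_; _⊓_; _≤_; _<_)
  import Data.Nat.Properties as ℕ
  import Data.Rational.Properties as ℚ
  open import Data.Bool using (Bool; true; false; not; if_then_else_)
  open import Data.Bool.Properties using (T-≡)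
  open import Data.Fin using (Fin; fromℕ; inject₁) renaming (zero to fzero; suc to fsuc)
  open import Data.Fin.Subset using (Subset; _∈_; _⊆_; _∩_; ∣_∣)
  open import Data.Fin.Subset.Properties using (p⊆q⇒∣p∣≤∣q∣)
  open import Data.Vec using (Vec; []; _∷_; lookup; tabulate)
  import Data.Vec.Relation.Unary.Any as Any
  open import Data.Vec.Relation.Unary.All as All using (All; []; _∷_)
  open import Data.Vec.Relation.Unary.AllPairs using ([]; _∷_)
  open import Data.Vec.Relation.Unary.Unique.Propositional using (Unique)
  open import Data.Vec.Relation.Unary.Unique.Propositional.Properties using (lookup-injective)
  open import Data.Vec.Membership.Propositional using () renaming (_∉_ to _∉ᵥ_)
  open import Data.Product using (Σ; ∃-syntax; _×_; _,_; proj₁; proj₂)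
  open import Data.Sum using ([_,_]′)
  open import Function.Base using (_∘_)
  open import Function.Bundles using (Equivalence)
  open import Relation.Binary.PropositionalEquality
  open RationalArithmetic using (ℕtoℚ-mono-≤; ℕtoℚ-cancel-≤)
  open SubsetCounting

  edge : Bool → Fin n → Fin n → Bool
  edge b u w = if b then adj G u w else adj G w u

  edge-flip : ∀ b u w → edge (not b) w u ≡ edge b u w
  edge-flip true  u w = refl
  edge-flip false u w = refl

  Follows : ∀ {m} → PathOrientation m → Vec (Fin n) (suc m) → Set
  Follows σ vs = ∀ i → edge (lookup σ i) (lookup vs (inject₁ i)) (lookup vs (fsuc i)) ≡ true

  follows-∷ : ∀ {m b u w} {σ : PathOrientation m} {ws} →
              edge b u w ≡ true → Follows σ (w ∷ ws) → Follows (b ∷ σ) (u ∷ w ∷ ws)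
  follows-∷ uw _  fzero    = uw
  follows-∷ _  σw (fsuc i) = σw i

  -- nbr true u and nbr false u are definitionally N⁺ G u and N⁻ G u.
  nbr : Bool → Fin n → Subset n
  nbr b u = tabulate (edge b u)

  lo≤∣nbr∣ : ∀ b u → lo ≤ ∣ nbr b u ∣
  lo≤∣nbr∣ true  u = proj₁ (lo≤δ⁰ u)
  lo≤∣nbr∣ false u = proj₂ (lo≤δ⁰ u)

  hasRobustNbrsIn : Bool → Subset n → Fin n → Bool
  hasRobustNbrsIn b S u = ν ℚ.* ℕtoℚ n ℚ.≤ᵇ ℕtoℚ ∣ S ∩ nbr b u ∣

  -- robustNbr true and robustNbr false are definitionally RN⁻ G ν and RN⁺ G ν.
  robustNbr : Bool → Subset n → Subset n
  robustNbr b S = tabulate (hasRobustNbrsIn b S)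

  ∈robustNbr⁺ : ∀ {b S u} → ν ℚ.* ℕtoℚ n ℚ.≤ ℕtoℚ ∣ S ∩ nbr b u ∣ → u ∈ robustNbr b S
  ∈robustNbr⁺ {b} {S} νn≤ = ∈-tabulate⁺ {f = hasRobustNbrsIn b S} (Equivalence.to T-≡ (ℚ.≤⇒≤ᵇ νn≤))

  ∈robustNbr⁻ : ∀ {b S u} → u ∈ robustNbr b S → ν ℚ.* ℕtoℚ n ℚ.≤ ℕtoℚ ∣ S ∩ nbr b u ∣
  ∈robustNbr⁻ {b} {S} u∈ = ℚ.≤ᵇ⇒≤ (Equivalence.from T-≡ (∈-tabulate⁻ {f = hasRobustNbrsIn b S} u∈))

  d≤∣S∩nbr∣ : ∀ {b S u} → u ∈ robustNbr b S → d ≤ ∣ S ∩ nbr b u ∣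
  d≤∣S∩nbr∣ {b} {S} {u} u∈ = ℕtoℚ-cancel-≤ (ℚ.≤-trans d≤νn (∈robustNbr⁻ {b} {S} {u} u∈))

  robustNbr-mono : ∀ b {S T} → S ⊆ T → robustNbr b S ⊆ robustNbr b T
  robustNbr-mono b {S} {T} S⊆T {u} u∈ =
    ∈robustNbr⁺ {b} {T} {u}
      (ℚ.≤-trans (∈robustNbr⁻ {b} {S} {u} u∈) (ℕtoℚ-mono-≤ (p⊆q⇒∣p∣≤∣q∣ (∩-monoˡ-⊆ S⊆T))))

  robustNbr-expands : ∀ b S → lo ≤ ∣ S ∣ → ∣ S ∣ ≤ hi → ∣ S ∣ + d ≤ ∣ robustNbr b S ∣
  robustNbr-expands true  S lo≤∣S∣ ∣S∣≤hi = proj₂ (expands S lo≤∣S∣ ∣S∣≤hi)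
  robustNbr-expands false S lo≤∣S∣ ∣S∣≤hi = proj₁ (expands S lo≤∣S∣ ∣S∣≤hi)

  hi+d≤∣robustNbr∣ : ∀ b S → hi ≤ ∣ S ∣ → hi + d ≤ ∣ robustNbr b S ∣
  hi+d≤∣robustNbr∣ b S hi≤∣S∣ = via-subset (∃-subset-of-size S hi≤∣S∣)
    where
    via-subset : ∃[ S′ ] S′ ⊆ S × ∣ S′ ∣ ≡ hi → hi + d ≤ ∣ robustNbr b S ∣
    via-subset (S′ , S′⊆S , ∣S′∣≡hi) = begin
      hi + d             ≡⟨ cong (_+ d) ∣S′∣≡hi ⟨
      ∣ S′ ∣ + d         ≤⟨ robustNbr-expands b S′ (subst (lo ≤_) (sym ∣S′∣≡hi) lo≤hi) (ℕ.≤-reflexive ∣S′∣≡hi) ⟩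
      ∣ robustNbr b S′ ∣ ≤⟨ p⊆q⇒∣p∣≤∣q∣ (robustNbr-mono b S′⊆S) ⟩
      ∣ robustNbr b S ∣  ∎
      where open ℕ.≤-Reasoning

  robustNbr-grows : ∀ b S → lo ≤ ∣ S ∣ → ∣ S ∣ ⊓ hi + d ≤ ∣ robustNbr b S ∣
  robustNbr-grows b S lo≤∣S∣ = [ small , large ]′ (ℕ.≤-total ∣ S ∣ hi)
    where
    small : ∣ S ∣ ≤ hi → ∣ S ∣ ⊓ hi + d ≤ ∣ robustNbr b S ∣
    small ∣S∣≤hi = subst (λ s → s + d ≤ ∣ robustNbr b S ∣) (sym (ℕ.m≤n⇒m⊓n≡m ∣S∣≤hi))
      (robustNbr-expands b S lo≤∣S∣ ∣S∣≤hi)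
    large : hi ≤ ∣ S ∣ → ∣ S ∣ ⊓ hi + d ≤ ∣ robustNbr b S ∣
    large hi≤∣S∣ = subst (λ s → s + d ≤ ∣ robustNbr b S ∣) (sym (ℕ.m≥n⇒m⊓n≡n hi≤∣S∣))
      (hi+d≤∣robustNbr∣ b S hi≤∣S∣)

  module _ (t : Fin n) where

    -- The sets T(σ) of the proof idea.
    target : ∀ {m} → PathOrientation (suc m) → Subset n
    target (b ∷ [])    = nbr (not b) t
    target (b ∷ c ∷ σ) = robustNbr b (target (c ∷ σ))

    ∣target∣ : ∀ {m} (σ : PathOrientation (suc m)) → (lo + m * d) ⊓ (hi + d) ≤ ∣ target σ ∣
    ∣target∣ (b ∷ []) = ℕ.≤-trans (ℕ.m⊓n≤m (lo + 0) _)
      (subst (_≤ ∣ nbr (not b) t ∣) (sym (ℕ.+-identityʳ lo)) (lo≤∣nbr∣ (not b) t))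
    ∣target∣ {suc m} (b ∷ c ∷ σ) = begin
      (lo + (d + m * d)) ⊓ (hi + d) ≡⟨ cong (λ e → (lo + e) ⊓ (hi + d)) (ℕ.+-comm d (m * d)) ⟩
      (lo + (m * d + d)) ⊓ (hi + d) ≡⟨ cong (_⊓ (hi + d)) (ℕ.+-assoc lo (m * d) d) ⟨
      (lo + m * d + d) ⊓ (hi + d)   ≡⟨ ℕ.+-distribʳ-⊓ d (lo + m * d) hi ⟨
      (lo + m * d) ⊓ hi + d         ≤⟨ ℕ.+-monoˡ-≤ d (ℕ.⊓-glb
                                         (ℕ.≤-trans (ℕ.⊓-monoʳ-≤ (lo + m * d) (ℕ.m≤m+n hi d)) IH)
                                         (ℕ.m⊓n≤n (lo + m * d) hi)) ⟩
      ∣ T ∣ ⊓ hi + d                ≤⟨ robustNbr-grows b T lo≤∣T∣ ⟩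
      ∣ robustNbr b T ∣             ∎
      where
      open ℕ.≤-Reasoning
      T = target (c ∷ σ)
      IH = ∣target∣ (c ∷ σ)
      lo≤∣T∣ : lo ≤ ∣ T ∣
      lo≤∣T∣ = ℕ.≤-trans (ℕ.⊓-glb (ℕ.m≤m+n lo (m * d)) (ℕ.≤-trans lo≤hi (ℕ.m≤m+n hi d))) IH

    Completion : ∀ {m j} → PathOrientation (suc m) → Fin n → Vec (Fin n) j → Set
    Completion {m} σ v us = ∃[ ws ] Follows σ (v ∷ ws) × Unique ws × All (_∉ᵥ us) ws × lookup ws (fromℕ m) ≡ t

    complete : ∀ {m j} (σ : PathOrientation (suc m)) {v} (us : Vec (Fin n) j) →
               v ∈ target σ → j + m < d → t ∉ᵥ us → Completion σ v us
    complete (b ∷ []) {v} us v∈ _ t∉us =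
      t ∷ [] , follows-∷ (trans (sym (edge-flip b v t)) (∈-tabulate⁻ v∈)) (λ ()) , [] ∷ [] , t∉us ∷ [] , refl
    complete {suc m} {j} (b ∷ c ∷ σ) {v} us v∈ j+1+m<d t∉us =
      prepend (∃-∈∩-∉ᵥ (target (c ∷ σ)) (nbr b v) (t ∷ us) room)
      where
      1+j+m<d : suc j + m < d
      1+j+m<d = subst (_< d) (ℕ.+-suc j m) j+1+m<d
      room : suc j < ∣ target (c ∷ σ) ∩ nbr b v ∣
      room = ℕ.<-≤-trans (ℕ.≤-<-trans (ℕ.m≤m+n (suc j) m) 1+j+m<d) (d≤∣S∩nbr∣ {b} {target (c ∷ σ)} {v} v∈)
      prepend : ∃[ w ] w ∈ target (c ∷ σ) × w ∈ nbr b v × w ∉ᵥ t ∷ us → Completion (b ∷ c ∷ σ) v us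
      prepend (w , w∈T , w∈N , w∉t∷us) = extend (complete (c ∷ σ) (w ∷ us) w∈T 1+j+m<d t∉w∷us)
        where
        t∉w∷us : t ∉ᵥ w ∷ us
        t∉w∷us = ∉ᵥ-∷⁺ (λ t≡w → w∉t∷us (Any.here (sym t≡w))) t∉us
        extend : Completion (c ∷ σ) w (w ∷ us) → Completion (b ∷ c ∷ σ) v us
        extend (ws , follows , unique , avoids , ends) =
            w ∷ ws
          , follows-∷ (∈-tabulate⁻ w∈N) follows
          , All.map (λ z∉w∷us w≡z → z∉w∷us (Any.here (sym w≡z))) avoids ∷ unique
          , (w∉t∷us ∘ Any.there) ∷ All.map (_∘ Any.there) avoids
          , ends

  n+3≤lo+∣target∣ : ∀ {m} → n + 3 ≤ m * d → n + 3 ≤ lo + (lo + m * d) ⊓ (hi + d)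
  n+3≤lo+∣target∣ {m} n+3≤md = subst (n + 3 ≤_) (sym (ℕ.+-distribˡ-⊓ lo (lo + m * d) (hi + d)))
    (ℕ.⊓-glb (ℕ.≤-trans n+3≤md (ℕ.≤-trans (ℕ.m≤n+m (m * d) lo) (ℕ.m≤n+m (lo + m * d) lo))) n+3≤lo+hi+d)

  embed : ∀ m (x y : Fin n) → x ≢ y → (P : PathOrientation (2 + m)) → 2 + m < d → n + 3 ≤ m * d →
          Σ (Fin (3 + m) → Fin n) λ f → IsomorphicPathFromTo G P x y f
  embed m x y x≢y (b ∷ σ) 2+m<d n+3≤md = start (∃-∈∩-∉ᵥ (nbr b x) (target y σ) (x ∷ y ∷ []) 2<∣N∩T∣)
    where
    2<∣N∩T∣ : 2 < ∣ nbr b x ∩ target y σ ∣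
    2<∣N∩T∣ = ℕ.+-cancelˡ-≤ n 3 _ (begin
      n + 3                         ≤⟨ n+3≤lo+∣target∣ {m} n+3≤md ⟩
      lo + (lo + m * d) ⊓ (hi + d)  ≤⟨ ℕ.+-mono-≤ (lo≤∣nbr∣ b x) (∣target∣ y σ) ⟩
      ∣ nbr b x ∣ + ∣ target y σ ∣  ≤⟨ ∣p∣+∣q∣≤∣p∩q∣+n (nbr b x) (target y σ) ⟩
      ∣ nbr b x ∩ target y σ ∣ + n  ≡⟨ ℕ.+-comm _ n ⟩
      n + ∣ nbr b x ∩ target y σ ∣  ∎)
      where open ℕ.≤-Reasoning
    start : ∃[ v ] v ∈ nbr b x × v ∈ target y σ × v ∉ᵥ x ∷ y ∷ [] →
            Σ (Fin (3 + m) → Fin n) λ f → IsomorphicPathFromTo G (b ∷ σ) x y f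
    start (v , v∈N , v∈T , v∉xy) = finish (complete y σ (v ∷ x ∷ []) v∈T 2+m<d y∉vx)
      where
      y∉vx : y ∉ᵥ v ∷ x ∷ []
      y∉vx = ∉ᵥ-∷⁺ (λ y≡v → v∉xy (Any.there (Any.here (sym y≡v)))) (∉ᵥ-∷⁺ (x≢y ∘ sym) λ ())
      finish : Completion y σ v (v ∷ x ∷ []) →
               Σ (Fin (3 + m) → Fin n) λ f → IsomorphicPathFromTo G (b ∷ σ) x y f
      finish (ws , follows , unique , avoids , ends) =
          lookup (x ∷ v ∷ ws)
        , (λ {i} {j} → lookup-injective unique-xvws i j)
        , refl
        , ends
        , follows-∷ (∈-tabulate⁻ v∈N) follows
        where
        unique-xvws : Unique (x ∷ v ∷ ws)
        unique-xvws = ((λ x≡v → v∉xy (Any.here (sym x≡v)))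
                         ∷ All.map (λ z∉vx x≡z → z∉vx (Any.there (Any.here (sym x≡z)))) avoids)
                    ∷ All.map (λ z∉vx v≡z → z∉vx (Any.here (sym v≡z))) avoids
                    ∷ unique

module Parameters (η τ ν : ℚ.ℚ) (n k : ℕ.ℕ)
  (η≤1 : η ℚ.≤ ℚ.1ℚ) (τ≤η⅛ : τ ℚ.≤ η ℚ.* RationalArithmetic.⅛) (0<ν : ℚ.0ℚ ℚ.< ν) (ν≤τ : ν ℚ.≤ τ)
  (2≤νk : ℕtoℚ 2 ℚ.≤ ν ℚ.* ℕtoℚ k) (k≤νn¼ : ℕtoℚ k ℚ.≤ (ν ℚ.* ℕtoℚ n) ÷4)
  where

  open import Data.Nat using (ℕ; suc)
  import Data.Nat.Properties as ℕ
  open import Data.Integer using (+_)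
  open import Data.Rational using (ℚ; 0ℚ; 1ℚ; _≤_; _<_; _+_; _*_; _-_)
  import Data.Rational.Properties as ℚ
  open import Data.Rational.Solver using (module +-*-Solver)
  open import Data.Product using (_,_; proj₁; proj₂)
  open import Relation.Binary.PropositionalEquality
  open RationalArithmetic
  open +-*-Solver

  private
    N K : ℚ
    N = ℕtoℚ n
    K = ℕtoℚ k

  ν≤⅛ : ν ≤ ⅛
  ν≤⅛ = ≤-from-slack
    (0≤+ (0≤+ (0≤-slack ν≤τ) (0≤-slack τ≤η⅛)) (0≤* (0≤-slack η≤1) (ℚ.nonNegative⁻¹ ⅛)))
    (solve 3 (λ ν τ η → (τ :- ν) :+ (η :* con ⅛ :- τ) :+ (con 1ℚ :- η) :* con ⅛ := con ⅛ :- ν) refl ν τ η)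

  τ≤⅛ : τ ≤ ⅛
  τ≤⅛ = ≤-from-slack (0≤+ (0≤-slack τ≤η⅛) (0≤* (0≤-slack η≤1) (ℚ.nonNegative⁻¹ ⅛)))
    (solve 2 (λ τ η → (η :* con ⅛ :- τ) :+ (con 1ℚ :- η) :* con ⅛ := con ⅛ :- τ) refl τ η)

  16≤k : 16 ℕ.≤ k
  16≤k = ℕtoℚ-cancel-≤ (≤-from-slack
    (0≤+ (0≤* (0≤ℕtoℚ 8) (0≤-slack 2≤νk)) (0≤* (0≤ℕtoℚ 8) (0≤* (0≤ℕtoℚ k) (0≤-slack ν≤⅛))))
    (solve 2 (λ ν K → con (ℕtoℚ 8) :* (ν :* K :- con (ℕtoℚ 2)) :+ con (ℕtoℚ 8) :* (K :* (con ⅛ :- ν))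
                      := K :- con (ℕtoℚ 16)) refl ν K))

  64≤νn : ℕtoℚ 64 ≤ ν * N
  64≤νn = ≤-from-slack
    (0≤+ (0≤* (0≤ℕtoℚ 4) (0≤-slack k≤νn¼)) (0≤* (0≤ℕtoℚ 4) (0≤-slack (ℕtoℚ-mono-≤ 16≤k))))
    (solve 3 (λ ν N K → con (ℕtoℚ 4) :* (ν :* N :* con ¼ :- K) :+ con (ℕtoℚ 4) :* (K :- con (ℕtoℚ 16))
                        := ν :* N :- con (ℕtoℚ 64)) refl ν N K)

  private
    0≤N : 0ℚ ≤ N
    0≤N = 0≤ℕtoℚ n
    ⌊νn⌋ = floorℕ (ν * N) (0≤* (ℚ.<⇒≤ 0<ν) 0≤N)
    ⌊τn⌋ = floorℕ (τ * N) (0≤* (ℚ.≤-trans (ℚ.<⇒≤ 0<ν) ν≤τ) 0≤N)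

  d lo hi : ℕ
  d  = proj₁ ⌊νn⌋
  lo = suc (proj₁ ⌊τn⌋)
  hi = n ℕ.∸ lo

  d≤νn : ℕtoℚ d ≤ ν * N
  d≤νn = proj₁ (proj₂ ⌊νn⌋)

  τn<lo : τ * N < ℕtoℚ lo
  τn<lo = proj₂ (proj₂ ⌊τn⌋)

  private
    D T : ℚ
    D = ℕtoℚ d
    T = ℕtoℚ (proj₁ ⌊τn⌋)
    νn<1+d : ν * N < ℕtoℚ 1 + D
    νn<1+d = subst (ν * N <_) (ℕtoℚ-homo-+ 1 d) (proj₂ (proj₂ ⌊νn⌋))
    T≤τn : T ≤ τ * N
    T≤τn = proj₁ (proj₂ ⌊τn⌋)
    lo≡1+T : ℕtoℚ lo ≡ ℕtoℚ 1 + T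
    lo≡1+T = ℕtoℚ-homo-+ 1 (proj₁ ⌊τn⌋)

  -- lo ≤ τn + 1 ≤ ηn, as ηn ≥ 8τn and τn ≥ νn ≥ 64.
  lo≤ηn : ℕtoℚ lo ≤ η * N
  lo≤ηn = subst (_≤ η * N) (sym lo≡1+T) (≤-from-slack
    (0≤+ (0≤+ (0≤+ (0≤+ (0≤-slack T≤τn) (0≤* (0≤ℕtoℚ 8) (0≤* 0≤N (0≤-slack τ≤η⅛))))
                   (0≤* (0≤ℕtoℚ 7) (0≤* 0≤N (0≤-slack ν≤τ))))
              (0≤* (0≤ℕtoℚ 7) (0≤-slack 64≤νn)))
         (0≤ℕtoℚ 447))
    (solve 5 (λ η τ ν N T → (τ :* N :- T) :+ con (ℕtoℚ 8) :* (N :* (η :* con ⅛ :- τ))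
                            :+ con (ℕtoℚ 7) :* (N :* (τ :- ν))
                            :+ con (ℕtoℚ 7) :* (ν :* N :- con (ℕtoℚ 64)) :+ con (ℕtoℚ 447)
                          := η :* N :- (con (ℕtoℚ 1) :+ T)) refl η τ ν N T))

  -- 2(τn + 1) ≤ n, as τ ≤ 1/8 and νn ≥ 64 with ν ≤ 1/8.
  lo+lo≤n : lo ℕ.+ lo ℕ.≤ n
  lo+lo≤n = ℕtoℚ-cancel-≤ (subst (_≤ N) (sym (trans (ℕtoℚ-homo-+ lo lo) (cong₂ _+_ lo≡1+T lo≡1+T)))
    (≤-from-slack
    (0≤+ (0≤+ (0≤+ (0≤+ (0≤* (0≤ℕtoℚ 2) (0≤-slack T≤τn)) (0≤* (0≤ℕtoℚ 2) (0≤* 0≤N (0≤-slack τ≤⅛))))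
                   (0≤* (0≤ℕtoℚ 6) (0≤* 0≤N (0≤-slack ν≤⅛))))
              (0≤* (0≤ℕtoℚ 6) (0≤-slack 64≤νn)))
         (0≤ℕtoℚ 382))
    (solve 4 (λ τ ν N T → con (ℕtoℚ 2) :* (τ :* N :- T) :+ con (ℕtoℚ 2) :* (N :* (con ⅛ :- τ))
                          :+ con (ℕtoℚ 6) :* (N :* (con ⅛ :- ν))
                          :+ con (ℕtoℚ 6) :* (ν :* N :- con (ℕtoℚ 64)) :+ con (ℕtoℚ 382)
                        := N :- ((con (ℕtoℚ 1) :+ T) :+ (con (ℕtoℚ 1) :+ T))) refl τ ν N T)))

  4k≤d : 4 ℕ.* k ℕ.≤ d
  4k≤d = ℕ.≤-pred (ℕtoℚ-cancel-< (subst₂ _<_ (sym (ℕtoℚ-homo-* 4 k)) (sym (ℕtoℚ-homo-+ 1 d))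
    (ℚ.≤-<-trans
    (≤-from-slack (0≤* (0≤ℕtoℚ 4) (0≤-slack k≤νn¼))
      (solve 3 (λ ν N K → con (ℕtoℚ 4) :* (ν :* N :* con ¼ :- K) := ν :* N :- con (ℕtoℚ 4) :* K) refl ν N K))
    νn<1+d)))

  -- (k-2)d ≥ (k-2)(νn-1) ≥ 2n - 2νn - k ≥ n + 3, using νk ≥ 2, ν ≤ 1/8, k ≤ νn/4 and νn ≥ 64.
  n+3≤[k-2]d : ∀ m → k ≡ 2 ℕ.+ m → n ℕ.+ 3 ℕ.≤ m ℕ.* d
  n+3≤[k-2]d m k≡2+m = ℕtoℚ-cancel-≤ (subst₂ _≤_ (sym (ℕtoℚ-homo-+ n 3)) (sym (ℕtoℚ-homo-* m d))
    (≤-from-slack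
    (0≤+ (0≤+ (0≤+ (0≤+ (0≤+ (0≤* (0≤ℕtoℚ m) (ℚ.<⇒≤ (0<-slack νn<1+d)))
                             (0≤* 0≤N (subst (λ K → 0ℚ ≤ ν * K - ℕtoℚ 2) K≡2+M (0≤-slack 2≤νk))))
                        (subst (λ K → 0ℚ ≤ ν * N * ¼ - K) K≡2+M (0≤-slack k≤νn¼)))
                   (0≤* (0≤ℕtoℚ 8) (0≤* 0≤N (0≤-slack ν≤⅛))))
              (0≤* (ℚ.nonNegative⁻¹ (+ 23 ℚ./ 4)) (0≤-slack 64≤νn)))
         (0≤ℕtoℚ 367))
    (solve 4 (λ ν N M D → M :* (con (ℕtoℚ 1) :+ D :- ν :* N)
                          :+ N :* (ν :* (con (ℕtoℚ 2) :+ M) :- con (ℕtoℚ 2))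
                          :+ (ν :* N :* con ¼ :- (con (ℕtoℚ 2) :+ M)) :+ con (ℕtoℚ 8) :* (N :* (con ⅛ :- ν))
                          :+ con (+ 23 ℚ./ 4) :* (ν :* N :- con (ℕtoℚ 64)) :+ con (ℕtoℚ 367)
                        := M :* D :- (N :+ con (ℕtoℚ 3))) refl ν N (ℕtoℚ m) D)))
    where
    K≡2+M : K ≡ ℕtoℚ 2 + ℕtoℚ m
    K≡2+M = trans (cong ℕtoℚ k≡2+m) (ℕtoℚ-homo-+ 2 m)

  lo≤n : lo ℕ.≤ n
  lo≤n = ℕ.m+n≤o⇒m≤o lo lo+lo≤n

  lo≤hi : lo ℕ.≤ hi
  lo≤hi = ℕ.m+n≤o⇒m≤o∸n lo lo+lo≤n

  k<d : k ℕ.< d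
  k<d = ℕ.<-≤-trans (ℕ.m<m+n k 0<3k) 4k≤d
    where
    0<3k : 0 ℕ.< 3 ℕ.* k
    0<3k = ℕ.<-≤-trans (ℕ.s≤s ℕ.z≤n) (ℕ.≤-trans 16≤k (ℕ.m≤m+n k (2 ℕ.* k)))

  n+3≤lo+[hi+d] : n ℕ.+ 3 ℕ.≤ lo ℕ.+ (hi ℕ.+ d)
  n+3≤lo+[hi+d] = begin
    n ℕ.+ 3           ≤⟨ ℕ.+-monoʳ-≤ n (ℕ.≤-trans (ℕ.m≤m+n 3 13) (ℕ.≤-trans 16≤k (ℕ.<⇒≤ k<d))) ⟩
    n ℕ.+ d           ≡⟨ cong (ℕ._+ d) (ℕ.m+[n∸m]≡n lo≤n) ⟨
    lo ℕ.+ hi ℕ.+ d   ≡⟨ ℕ.+-assoc lo hi d ⟩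
    lo ℕ.+ (hi ℕ.+ d) ∎
    where open ℕ.≤-Reasoning

  τn<s<[1-τ]n : ∀ {s} → lo ℕ.≤ s → s ℕ.≤ hi → τ * N < ℕtoℚ s × ℕtoℚ s < (1ℚ - τ) * N
  τn<s<[1-τ]n {s} lo≤s s≤hi = ℚ.<-≤-trans τn<lo (ℕtoℚ-mono-≤ lo≤s) , <-from-slack
    (0<+ (0<-slack τn<lo) (0≤-slack s+lo≤n))
    (solve 4 (λ τ N S L → (L :- τ :* N) :+ (N :- (S :+ L)) := (con 1ℚ :- τ) :* N :- S)
           refl τ N (ℕtoℚ s) (ℕtoℚ lo))
    where
    s+lo≤n : ℕtoℚ s + ℕtoℚ lo ≤ N
    s+lo≤n = subst (_≤ N) (ℕtoℚ-homo-+ s lo) (ℕtoℚ-mono-≤ (ℕ.m≤o∸n⇒m+n≤o s lo≤n s≤hi))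

  s+νn≤r⇒s+d≤r : ∀ {s r} → ℕtoℚ s + ν * N ≤ ℕtoℚ r → s ℕ.+ d ℕ.≤ r
  s+νn≤r⇒s+d≤r {s} s+νn≤r = ℕtoℚ-cancel-≤
    (subst (_≤ _) (sym (ℕtoℚ-homo-+ s d)) (ℚ.≤-trans (ℚ.+-monoʳ-≤ (ℕtoℚ s) d≤νn) s+νn≤r))

open RationalArithmetic using (ℕtoℚ-cancel-≤; ceiling≤⇒≤; ⅛)
open import Data.Nat using (ℕ; _≥_; suc)
import Data.Nat.Properties as ℕ
open import Data.Integer using (+_) renaming (_≤_ to _≤ℤ_)
open import Data.Rational using (ℚ; 0ℚ; _<_; _≤_; _*_)
import Data.Rational.Properties as ℚ
open import Data.Rational.Solver using (module +-*-Solver)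
open import Data.Fin using (Fin)
open import Data.Product as Product using (Σ; _×_; _,_)
open import Relation.Binary.PropositionalEquality using (_≡_; _≢_; sym; trans; cong; subst)
open import Function.Base using (_∘_)

⌈2/ν⌉≤k⇒2≤νk : ∀ ν (0<ν : 0ℚ < ν) k → ⌈2/ ν ⌉ 0<ν ≤ℤ + k → ℕtoℚ 2 ≤ ν * ℕtoℚ k
⌈2/ν⌉≤k⇒2≤νk ν 0<ν k ⌈2/ν⌉≤k = subst (_≤ ν * ℕtoℚ k) ν*[2÷ν]≡2
  (ℚ.*-monoˡ-≤-nonNeg ν {{ℚ.nonNegative (ℚ.<⇒≤ 0<ν)}} (ceiling≤⇒≤ _ k ⌈2/ν⌉≤k))
  where
  instance
    ν≢0 : ℚ.NonZero ν
    ν≢0 = ℚ.pos⇒nonZero ν {{ℚ.positive 0<ν}}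
  open +-*-Solver
  ν*[2÷ν]≡2 : ν * (ℕtoℚ 2 ℚ.÷ ν) ≡ ℕtoℚ 2
  ν*[2÷ν]≡2 = trans (solve 3 (λ ν a r → ν :* (a :* r) := a :* (ν :* r)) _≡_.refl ν (ℕtoℚ 2) (ℚ.1/ ν))
                   (trans (cong (ℕtoℚ 2 *_) (ℚ.*-inverseʳ ν)) (ℚ.*-identityʳ (ℕtoℚ 2)))

orientedPath : ∀ {η τ ν n k} (G : Digraph n) → η ≤ ℚ.1ℚ → τ ≤ η * ⅛ → 0ℚ < ν → ν ≤ τ →
               RobustDiexpander G ν τ → minSemiDegreeAtLeast G η →
               ℕtoℚ 2 ≤ ν * ℕtoℚ k → ℕtoℚ k ≤ (ν * ℕtoℚ n) ÷4 →
               ∀ x y → x ≢ y → (P : PathOrientation k) →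
               Σ (Fin (suc k) → Fin n) λ f → IsomorphicPathFromTo G P x y f
orientedPath {η} {τ} {ν} {n} {k} G η≤1 τ≤η⅛ 0<ν ν≤τ expander δ⁰ 2≤νk k≤νn¼ x y x≢y =
  subst (λ j → (P : PathOrientation j) → Σ (Fin (suc j) → Fin n) λ f → IsomorphicPathFromTo G P x y f)
        (sym k≡2+m)
        (λ P → embed m x y x≢y P (subst (ℕ._< d) k≡2+m k<d) (n+3≤[k-2]d m k≡2+m))
  where
  open Parameters η τ ν n k η≤1 τ≤η⅛ 0<ν ν≤τ 2≤νk k≤νn¼
  m = k ℕ.∸ 2
  k≡2+m : k ≡ 2 ℕ.+ m
  k≡2+m = sym (ℕ.m+[n∸m]≡n (ℕ.≤-trans (ℕ.m≤m+n 2 14) 16≤k))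
  expands : ∀ S → lo ℕ.≤ ∣ S ∣ → ∣ S ∣ ℕ.≤ hi →
            (∣ S ∣ ℕ.+ d ℕ.≤ ∣ RN⁺ G ν S ∣) × (∣ S ∣ ℕ.+ d ℕ.≤ ∣ RN⁻ G ν S ∣)
  expands S lo≤∣S∣ ∣S∣≤hi = Product.map s+νn≤r⇒s+d≤r s+νn≤r⇒s+d≤r
    (Product.uncurry (expander S) (τn<s<[1-τ]n lo≤∣S∣ ∣S∣≤hi))
  lo≤δ⁰ : ∀ v → (lo ℕ.≤ outdeg G v) × (lo ℕ.≤ indeg G v)
  lo≤δ⁰ v = Product.map (ℕtoℚ-cancel-≤ ∘ ℚ.≤-trans lo≤ηn) (ℕtoℚ-cancel-≤ ∘ ℚ.≤-trans lo≤ηn) (δ⁰ v)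
  open PathEmbedding G ν d lo hi d≤νn expands lo≤δ⁰ lo≤hi n+3≤lo+[hi+d]

-- η₀ = 1 and τ₀ = η/8 work, and no lower bound on n is needed: 2/ν ≤ k ≤ νn/4 already forces νn ≥ 64.
mainTheorem12 :
    Σ ℚ λ η₀ → (0ℚ < η₀) ×
    (∀ (η : ℚ) → 0ℚ < η → η ≤ η₀ →
      Σ ℚ λ τ₀ → (0ℚ < τ₀) ×
      (∀ (τ : ℚ) → 0ℚ < τ → τ ≤ τ₀ →
        ∀ (ν : ℚ) (ν>0 : 0ℚ < ν) → ν ≤ τ →
          Σ ℕ λ n₀ →
            ∀ (n : ℕ) → n ≥ n₀ →
            ∀ (G : Digraph n) →
              RobustDiexpander G ν τ →
              minSemiDegreeAtLeast G η →
              ∀ (k : ℕ) → ⌈2/ ν ⌉ ν>0 ≤ℤ + k → ℕtoℚ k ≤ (ν * ℕtoℚ n) ÷4 →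
              ∀ (x y : Fin n) → x ≢ y →
              ∀ (P : PathOrientation k) →
                Σ (Fin (suc k) → Fin n) λ f → IsomorphicPathFromTo G P x y f))
mainTheorem12 =
  ℚ.1ℚ , ℚ.positive⁻¹ ℚ.1ℚ , λ η 0<η η≤1 →
  η * ⅛ , ℚ.positive⁻¹ (η * ⅛) {{ℚ.pos*pos⇒pos η {{ℚ.positive 0<η}} ⅛}} , λ τ _ τ≤η⅛ ν 0<ν ν≤τ →
  0 , λ n _ G expander δ⁰ k ⌈2/ν⌉≤k k≤νn¼ →
  orientedPath G η≤1 τ≤η⅛ 0<ν ν≤τ expander δ⁰ (⌈2/ν⌉≤k⇒2≤νk ν 0<ν k ⌈2/ν⌉≤k) k≤νn¼
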